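{- Let $m,n\ge1$ and let $F\subset\{1,\dots,m\}\times\{1,\dots,n\}$ be a binary image with row sums $r_i=\#\{j:(i,j)\in F\}$ ($i=1,\dots,m$) and column sums $c_j=\#\{i:(i,j)\in F\}$ ($j=1,\dots,n$), where $r_1=n$ and $r_m=0$. Let $L_h(F)$ be the length of the horizontal boundary of $F$. Define $b_i=\#\{j: c_j\ge i\}$ and $d_i=b_i-r_i$ for $i=1,\dots,m$. Let $k$ be an integer with $2\le k\le m-1$ such that $d_k<0$ and $d_{k+1}\ge0$, and let $\sigma=\sum_{i=1}^k d_i$. Then for all integers $t,s\ge0$, all indices $i_1<i_2<\dots<i_{2t+1}$ belonging to $\{1,2,\dots,k,m\}$ and all indices $\tilde i_1<\tilde i_2<\dots<\tilde i_{2s+1}$ belonging to $\{1,k+1,k+2,\dots,m\}$, we have \[ L_h(F)\ge 2n + d_{i_1}-d_{i_2}+d_{i_3}-\cdots-d_{i_{2t}}+2d_{i_{2t+1}} + d_{\tilde i_1}-d_{\tilde i_2}+d_{\tilde i_3}-\cdots-d_{\tilde i_{2s}}+2d_{\tilde i_{2s+1}}-\sigma. \]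
   Context: A binary image is a finite set $F\subset\mathbb{Z}^2$; row $i$ is $\{(x,y):x=i\}$ and column $j$ is $\{(x,y):y=j\}$. The horizontal boundary of $F$ is the set of ordered pairs of points $((i,j),(i',j))$ with $|i-i'|=1$, $(i,j)\in F$ and $(i',j)\notin F$ (points outside the $m\times n$ rectangle count as not in $F$); its length is the number of such pairs. -}

module Defs where

open import Data.Bool using (Bool; true; false; if_then_else_; not; _∧_)
open import Data.Nat using (ℕ; zero; suc; _+_; _*_; _∸_; _≤ᵇ_)
open import Data.Fin using (Fin; toℕ; fromℕ<; fromℕ; inject₁)
open import Data.Integer as ℤ using (ℤ; +_; -_)
open import Data.Nat.Properties using (_<?_)
import Data.Fin as Fin
open import Relation.Nullary.Decidable using (yes; no)

-- A binary image inside the m × n rectangle, given by its (decidable)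
-- indicator function on Fin m × Fin n; Fin index a corresponds to
-- row/column a+1 (the paper uses 1-based indices).
Image : ℕ → ℕ → Set
Image m n = Fin m → Fin n → Bool

-- membership with 1-based natural-number coordinates; points outside
-- {1..m} × {1..n} are not in F
inF : ∀ {m n} → Image m n → ℕ → ℕ → Bool
inF {m} {n} F zero j = false
inF {m} {n} F (suc i) zero = false
inF {m} {n} F (suc i) (suc j) with i <? m | j <? n
... | yes i<m | yes j<n = F (fromℕ< i<m) (fromℕ< j<n)
... | _ | _ = false

sumTo : ℕ → (ℕ → ℕ) → ℕ
sumTo zero f = 0
sumTo (suc n) f = sumTo n f + f (suc n)

sumToℤ : ℕ → (ℕ → ℤ) → ℤ
sumToℤ zero f = + 0
sumToℤ (suc n) f = sumToℤ n f ℤ.+ f (suc n)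

ind : Bool → ℕ
ind true = 1
ind false = 0

rowSum : ∀ {m n} → Image m n → ℕ → ℕ
rowSum {m} {n} F i = sumTo n (λ j → ind (inF F i j))

colSum : ∀ {m n} → Image m n → ℕ → ℕ
colSum {m} {n} F j = sumTo m (λ i → ind (inF F i j))

bSeq : ∀ {m n} → Image m n → ℕ → ℕ
bSeq {m} {n} F i = sumTo n (λ j → ind (i ≤ᵇ colSum F j))

dSeq : ∀ {m n} → Image m n → ℕ → ℤ
dSeq F i = + bSeq F i ℤ.- + rowSum F i

-- length of the horizontal boundary: number of ordered pairs
-- ((i,j),(i',j)) with |i - i'| = 1, (i,j) ∈ F, (i',j) ∉ F.
-- For (i,j) ∈ F we have 1 ≤ i ≤ m, 1 ≤ j ≤ n, and i' ∈ {i-1, i+1}.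
horizBoundary : ∀ {m n} → Image m n → ℕ
horizBoundary {m} {n} F =
  sumTo m (λ i → sumTo n (λ j →
    if inF F i j
    then ind (not (inF F (i ∸ 1) j)) + ind (not (inF F (suc i) j))
    else 0))

sumFin : ∀ l → (Fin l → ℤ) → ℤ
sumFin zero f = + 0
sumFin (suc l) f = f Fin.zero ℤ.+ sumFin l (λ p → f (Fin.suc p))

signℤ : ℕ → ℤ
signℤ zero = + 1
signℤ (suc p) = - signℤ p

-- for indices i_1 < ... < i_{2t+1} (given as ι : Fin (2t+1) → ℕ, ι p = i_{p+1}):
--   d_{i_1} - d_{i_2} + ... - d_{i_{2t}} + 2 d_{i_{2t+1}}
altExpr : (ℕ → ℤ) → (t : ℕ) → (Fin (suc (2 * t)) → ℕ) → ℤ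
altExpr d t ι =
  sumFin (2 * t) (λ p → signℤ (toℕ p) ℤ.* d (ι (inject₁ p)))
  ℤ.+ (+ 2) ℤ.* d (ι (fromℕ (2 * t)))

module Submission where

open import Defs
open import Data.Bool using (Bool; true; false; not; _∧_; _∨_; _xor_; T; if_then_else_)
open import Data.Bool.Properties using (T-∧; T-≡)
open import Data.Empty using (⊥-elim)
open import Data.Fin as Fin using (Fin; toℕ; inject₁; fromℕ)
open import Data.Integer using (ℤ; +_; -_; 0ℤ; 1ℤ; -1ℤ; _+_; _-_; _*_; _≤_; _≥_; _<_; _≤ᵇ_; +≤+; _⊔_)
import Data.Integer.Properties as ℤP
open import Data.Integer.Tactic.RingSolver using (solve-∀)
open import Data.List using (List; []; _∷_; tabulate)
open import Data.List.Relation.Unary.All using (All; []; _∷_)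
import Data.List.Relation.Unary.All.Properties as All
open import Data.List.Relation.Unary.Linked using (Linked; []; [-]; _∷_)
open import Data.Nat as ℕ using (ℕ; zero; suc; z≤n; s≤s; _≟_)
import Data.Nat.Properties as ℕP
open import Data.Product using (Σ; _×_; _,_; proj₁; proj₂)
open import Data.Sum using (_⊎_; inj₁; inj₂)
open import Data.Unit using (tt)
open import Function.Base using (case_of_)
open import Function.Bundles using (Equivalence)
open import Relation.Nullary using (¬_; yes; no)
open import Relation.Unary using (U)
open import Relation.Binary.PropositionalEquality
  using (_≡_; refl; sym; trans; cong; cong₂; subst; subst₂; module ≡-Reasoning)

-- Write f_i = [(i,j) ∈ F] and a_i = [i ≤ c_j] for the cells of column j.  Then
-- d_i = Σ_j (a_i − f_i), and L_h(F) = Σ_j T_j where T_j is the number of colour changes along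
-- column j (cells outside the rectangle being white); r_1 = n and r_m = 0 say that every column
-- has f_1 = 1 and f_m = 0.  Once a final index k of the first sequence is moved to m, which only
-- increases the right-hand side since d_k < 0 ≤ d_m, the theorem is the sum over the columns of
--     2 + A(a − f) + B(a − f) − Σ_{i ≤ k} (a_i − f_i) ≤ T_j,
-- A and B being the two alternating sums.  Read from top to bottom, the column turns
-- A + B − Σ_{i ≤ k} (a_i − f_i) − T_j into the total gain of a run of a finite automaton whose
-- state records the phases of A and B, the previous cell, and whether a hole (a ∧ ¬f) or an
-- overflow (¬a ∧ f) has been met; the least solution of the Bellman inequalities is a potential
-- on the states that bounds the gain of every run by −2.

sumToℤ-distrib-+ : ∀ n (f g : ℕ → ℤ) → sumToℤ n (λ i → f i + g i) ≡ sumToℤ n f + sumToℤ n g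
sumToℤ-distrib-+ zero    f g = refl
sumToℤ-distrib-+ (suc n) f g rewrite sumToℤ-distrib-+ n f g =
  interchange (sumToℤ n f) (sumToℤ n g) (f (suc n)) (g (suc n))
  where
  interchange : ∀ a b x y → a + b + (x + y) ≡ a + x + (b + y)
  interchange = solve-∀

sumToℤ-neg : ∀ n (f : ℕ → ℤ) → sumToℤ n (λ i → - f i) ≡ - sumToℤ n f
sumToℤ-neg zero    f = refl
sumToℤ-neg (suc n) f rewrite sumToℤ-neg n f = sym (ℤP.neg-distrib-+ (sumToℤ n f) (f (suc n)))

sumToℤ-distrib-- : ∀ n (f g : ℕ → ℤ) → sumToℤ n (λ i → f i - g i) ≡ sumToℤ n f - sumToℤ n g
sumToℤ-distrib-- n f g =
  trans (sumToℤ-distrib-+ n f (λ i → - g i)) (cong (λ x → sumToℤ n f + x) (sumToℤ-neg n g))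

*-distribˡ-sumToℤ : ∀ n c (f : ℕ → ℤ) → sumToℤ n (λ i → c * f i) ≡ c * sumToℤ n f
*-distribˡ-sumToℤ zero    c f = sym (ℤP.*-zeroʳ c)
*-distribˡ-sumToℤ (suc n) c f rewrite *-distribˡ-sumToℤ n c f =
  sym (ℤP.*-distribˡ-+ c (sumToℤ n f) (f (suc n)))

sumToℤ-zero : ∀ n → sumToℤ n (λ _ → 0ℤ) ≡ 0ℤ
sumToℤ-zero zero    = refl
sumToℤ-zero (suc n) rewrite sumToℤ-zero n = refl

sumToℤ-const : ∀ n c → sumToℤ n (λ _ → + c) ≡ + (n ℕ.* c)
sumToℤ-const zero    c = refl
sumToℤ-const (suc n) c rewrite sumToℤ-const n c = cong +_ (ℕP.+-comm (n ℕ.* c) c)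

sumToℤ-comm : ∀ a b (g : ℕ → ℕ → ℤ) →
  sumToℤ a (λ i → sumToℤ b (g i)) ≡ sumToℤ b (λ j → sumToℤ a (λ i → g i j))
sumToℤ-comm zero    b g = sym (sumToℤ-zero b)
sumToℤ-comm (suc a) b g rewrite sumToℤ-comm a b g =
  sym (sumToℤ-distrib-+ b (λ j → sumToℤ a (λ i → g i j)) (g (suc a)))

sumToℤ-cong : ∀ n {f g : ℕ → ℤ} → (∀ i → 1 ℕ.≤ i → i ℕ.≤ n → f i ≡ g i) →
  sumToℤ n f ≡ sumToℤ n g
sumToℤ-cong zero    eq = refl
sumToℤ-cong (suc n) eq =
  cong₂ _+_ (sumToℤ-cong n (λ i 1≤i i≤n → eq i 1≤i (ℕP.m≤n⇒m≤1+n i≤n)))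
            (eq (suc n) (s≤s z≤n) ℕP.≤-refl)

sumToℤ-mono-≤ : ∀ n {f g : ℕ → ℤ} → (∀ i → 1 ℕ.≤ i → i ℕ.≤ n → f i ≤ g i) →
  sumToℤ n f ≤ sumToℤ n g
sumToℤ-mono-≤ zero    le = ℤP.≤-refl
sumToℤ-mono-≤ (suc n) le =
  ℤP.+-mono-≤ (sumToℤ-mono-≤ n (λ i 1≤i i≤n → le i 1≤i (ℕP.m≤n⇒m≤1+n i≤n)))
              (le (suc n) (s≤s z≤n) ℕP.≤-refl)

+-sumTo : ∀ n (f : ℕ → ℕ) → + sumTo n f ≡ sumToℤ n (λ i → + f i)
+-sumTo zero    f = refl
+-sumTo (suc n) f = trans (ℤP.pos-+ (sumTo n f) (f (suc n))) (cong (λ x → x + + f (suc n)) (+-sumTo n f))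

≤ᵇ-true : ∀ {m n} → m ℕ.≤ n → (m ℕ.≤ᵇ n) ≡ true
≤ᵇ-true m≤n = Equivalence.to T-≡ (ℕP.≤⇒≤ᵇ m≤n)

≤ᵇ-false : ∀ {m n} → n ℕ.< m → (m ℕ.≤ᵇ n) ≡ false
≤ᵇ-false {m} {n} n<m with m ℕ.≤ᵇ n in eq
... | false = refl
... | true  = ⊥-elim (ℕP.<⇒≱ n<m (ℕP.≤ᵇ⇒≤ m n (Equivalence.from T-≡ eq)))

sumToℤ-truncate : ∀ (f : ℕ → ℤ) {k} n → k ℕ.≤ n →
  sumToℤ n (λ r → if r ℕ.≤ᵇ k then f r else 0ℤ) ≡ sumToℤ k f
sumToℤ-truncate f {k} n k≤n with ℕP.m≤n⇒m<n∨m≡n k≤n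
... | inj₂ refl = sumToℤ-cong n (λ r _ r≤k → cong (λ b → if b then f r else 0ℤ) (≤ᵇ-true r≤k))
sumToℤ-truncate f {k} (suc n) _ | inj₁ k<n+1 rewrite ≤ᵇ-false {suc n} k<n+1 =
  trans (ℤP.+-identityʳ _) (sumToℤ-truncate f n (ℕP.≤-pred k<n+1))

ind-≤1 : ∀ b → ind b ℕ.≤ 1
ind-≤1 true  = ℕP.≤-refl
ind-≤1 false = z≤n

sumTo-ind-≤ : ∀ n (g : ℕ → Bool) → sumTo n (λ i → ind (g i)) ℕ.≤ n
sumTo-ind-≤ zero    g = z≤n
sumTo-ind-≤ (suc n) g =
  ℕP.≤-trans (ℕP.+-mono-≤ (sumTo-ind-≤ n g) (ind-≤1 (g (suc n)))) (ℕP.≤-reflexive (ℕP.+-comm n 1))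

sumTo-ind-< : ∀ n (g : ℕ → Bool) → 1 ℕ.≤ n → g n ≡ false → sumTo n (λ i → ind (g i)) ℕ.< n
sumTo-ind-< (suc n) g _ gn rewrite gn =
  s≤s (ℕP.≤-trans (ℕP.≤-reflexive (ℕP.+-identityʳ _)) (sumTo-ind-≤ n g))

term-≤-sumTo : ∀ n (g : ℕ → ℕ) {j} → 1 ℕ.≤ j → j ℕ.≤ n → g j ℕ.≤ sumTo n g
term-≤-sumTo zero    g 1≤j j≤0 = ⊥-elim (ℕP.<⇒≱ 1≤j j≤0)
term-≤-sumTo (suc n) g {j} 1≤j j≤n+1 with j ≟ suc n
... | yes refl  = ℕP.m≤n+m (g (suc n)) (sumTo n g)
... | no j≢n+1 =
  ℕP.≤-trans (term-≤-sumTo n g 1≤j (ℕP.≤-pred (ℕP.≤∧≢⇒< j≤n+1 j≢n+1)))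
             (ℕP.m≤m+n (sumTo n g) (g (suc n)))

sumTo-all-ones : ∀ n (g : ℕ → Bool) → sumTo n (λ i → ind (g i)) ≡ n →
  ∀ {j} → 1 ℕ.≤ j → j ℕ.≤ n → g j ≡ true
sumTo-all-ones zero    g full 1≤j j≤0 = ⊥-elim (ℕP.<⇒≱ 1≤j j≤0)
sumTo-all-ones (suc n) g full {j} 1≤j j≤n+1 with g (suc n) in last
... | false = ⊥-elim (ℕP.<⇒≱ (ℕP.n<1+n n)
                       (ℕP.≤-trans (ℕP.≤-reflexive (trans (sym full) (ℕP.+-identityʳ _))) (sumTo-ind-≤ n g)))
... | true with j ≟ suc n
...   | yes refl  = last
...   | no j≢n+1 = sumTo-all-ones n g (ℕP.suc-injective (trans (ℕP.+-comm 1 _) full)) 1≤j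
                                    (ℕP.≤-pred (ℕP.≤∧≢⇒< j≤n+1 j≢n+1))

sumTo-all-zeros : ∀ n (g : ℕ → Bool) → sumTo n (λ i → ind (g i)) ≡ 0 →
  ∀ {j} → 1 ℕ.≤ j → j ℕ.≤ n → g j ≡ false
sumTo-all-zeros n g empty {j} 1≤j j≤n with g j in gj
... | false = refl
... | true  = ⊥-elim (ℕP.<⇒≱ (subst (λ b → 1 ℕ.≤ ind b) (sym gj) ℕP.≤-refl)
                     (ℕP.≤-trans (term-≤-sumTo n (λ i → ind (g i)) 1≤j j≤n) (ℕP.≤-reflexive empty)))

sumTo-≤ᵇ : ∀ n c → sumTo n (λ i → ind (i ℕ.≤ᵇ c)) ≡ n ℕ.⊓ c
sumTo-≤ᵇ zero    c = refl
sumTo-≤ᵇ (suc n) c with suc n ℕ.≤? c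
... | yes n<c rewrite sumTo-≤ᵇ n c | ≤ᵇ-true n<c
                    | ℕP.m≤n⇒m⊓n≡m (ℕP.<⇒≤ n<c) | ℕP.m≤n⇒m⊓n≡m n<c =
  ℕP.+-comm n 1
... | no  n≮c rewrite sumTo-≤ᵇ n c | ≤ᵇ-false {suc n} (ℕP.≰⇒> n≮c)
                    | ℕP.m≥n⇒m⊓n≡n (ℕP.≤-pred (ℕP.≰⇒> n≮c))
                    | ℕP.m≥n⇒m⊓n≡n (ℕP.<⇒≤ (ℕP.≰⇒> n≮c)) =
  ℕP.+-identityʳ c

alternating : (ℕ → ℤ) → List ℕ → ℤ
alternating d []          = 0ℤ
alternating d (x ∷ [])    = + 2 * d x
alternating d (x ∷ y ∷ l) = d x - d y + alternating d l

alternating-cong : ∀ {d e : ℕ → ℤ} → (∀ i → d i ≡ e i) → ∀ l → alternating d l ≡ alternating e l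
alternating-cong eq []          = refl
alternating-cong eq (x ∷ [])    = cong (λ z → + 2 * z) (eq x)
alternating-cong eq (x ∷ y ∷ l) = cong₂ _+_ (cong₂ _-_ (eq x) (eq y)) (alternating-cong eq l)

alternating-sumToℤ : ∀ n (g : ℕ → ℕ → ℤ) l →
  alternating (λ i → sumToℤ n (λ j → g j i)) l ≡ sumToℤ n (λ j → alternating (g j) l)
alternating-sumToℤ n g []          = sym (sumToℤ-zero n)
alternating-sumToℤ n g (x ∷ [])    = sym (*-distribˡ-sumToℤ n (+ 2) (λ j → g j x))
alternating-sumToℤ n g (x ∷ y ∷ l) rewrite alternating-sumToℤ n g l =
  trans (cong (λ z → z + sumToℤ n (λ j → alternating (g j) l))
              (sym (sumToℤ-distrib-- n (λ j → g j x) (λ j → g j y))))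
        (sym (sumToℤ-distrib-+ n (λ j → g j x - g j y) (λ j → alternating (g j) l)))

data Even : ℕ → Set where
  even-zero : Even 0
  even-ss   : ∀ {n} → Even n → Even (suc (suc n))

even-double : ∀ t → Even (2 ℕ.* t)
even-double zero    = even-zero
even-double (suc t) = subst Even (cong suc (sym (ℕP.+-suc t (t ℕ.+ 0)))) (even-ss (even-double t))

sumFin-cong : ∀ N {g h : Fin N → ℤ} → (∀ p → g p ≡ h p) → sumFin N g ≡ sumFin N h
sumFin-cong zero    eq = refl
sumFin-cong (suc N) eq = cong₂ _+_ (eq Fin.zero) (sumFin-cong N (λ p → eq (Fin.suc p)))

altExpr-tabulate : ∀ d {N} → Even N → (ι : Fin (suc N) → ℕ) →
  sumFin N (λ p → signℤ (toℕ p) * d (ι (inject₁ p))) + + 2 * d (ι (fromℕ N))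
    ≡ alternating d (tabulate ι)
altExpr-tabulate d even-zero          ι = ℤP.+-identityˡ _
altExpr-tabulate d (even-ss {N} even) ι = begin
    (signℤ 0 * x + (signℤ 1 * y + S₂)) + last
  ≡⟨ cong (λ z → signℤ 0 * x + (signℤ 1 * y + z) + last)
          (sumFin-cong N λ p → cong (_* d (ι (Fin.suc (Fin.suc (inject₁ p)))))
                                    (ℤP.neg-involutive (signℤ (toℕ p)))) ⟩
    (signℤ 0 * x + (signℤ 1 * y + S)) + last
  ≡⟨ regroup x y S last ⟩
    x - y + (S + last)
  ≡⟨ cong (λ z → x - y + z) (altExpr-tabulate d even (λ p → ι (Fin.suc (Fin.suc p)))) ⟩
    alternating d (tabulate ι)
  ∎
  where
  open ≡-Reasoning
  x = d (ι Fin.zero)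
  y = d (ι (Fin.suc Fin.zero))
  last = + 2 * d (ι (fromℕ (suc (suc N))))
  S₂ = sumFin N (λ p → signℤ (toℕ (Fin.suc (Fin.suc p))) * d (ι (Fin.suc (Fin.suc (inject₁ p)))))
  S  = sumFin N (λ p → signℤ (toℕ p) * d (ι (Fin.suc (Fin.suc (inject₁ p)))))
  regroup : ∀ x y s z → + 1 * x + (- + 1 * y + s) + z ≡ x - y + (s + z)
  regroup = solve-∀

altExpr-alternating : ∀ d t ι → altExpr d t ι ≡ alternating d (tabulate ι)
altExpr-alternating d t = altExpr-tabulate d (even-double t)

data OddWithLast (Q : ℕ → Set) : List ℕ → Set where
  single : ∀ {x} → Q x → OddWithLast Q (x ∷ [])
  cons₂  : ∀ {x y l} → OddWithLast Q l → OddWithLast Q (x ∷ y ∷ l)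

record IndexList (Allowed Last : ℕ → Set) (l : List ℕ) : Set where
  field
    oddWithLast : OddWithLast Last l
    increasing  : Linked ℕ._<_ (0 ∷ l)
    allowed     : All Allowed l

tabulate-indexList : ∀ {Allowed : ℕ → Set} → (∀ {x} → Allowed x → 0 ℕ.< x) → ∀ {N} → Even N →
  (ι : Fin (suc N) → ℕ) → (∀ p q → p Fin.< q → ι p ℕ.< ι q) → (∀ p → Allowed (ι p)) →
  IndexList Allowed U (tabulate ι)
tabulate-indexList positive even ι mono allowed = record
  { oddWithLast = odd even ι ; increasing = linked ι mono (positive (allowed Fin.zero))
  ; allowed = All.tabulate⁺ allowed }
  where
  odd : ∀ {N} → Even N → (ι : Fin (suc N) → ℕ) → OddWithLast U (tabulate ι)
  odd even-zero    ι = single tt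
  odd (even-ss ev) ι = cons₂ (odd ev (λ p → ι (Fin.suc (Fin.suc p))))
  linked : ∀ {N} (ι : Fin (suc N) → ℕ) → (∀ p q → p Fin.< q → ι p ℕ.< ι q) →
    ∀ {lo} → lo ℕ.< ι Fin.zero → Linked ℕ._<_ (lo ∷ tabulate ι)
  linked {zero}  ι mono lo< = lo< ∷ [-]
  linked {suc N} ι mono lo< =
    lo< ∷ linked (λ p → ι (Fin.suc p)) (λ p q p<q → mono (Fin.suc p) (Fin.suc q) (s≤s p<q))
                 (mono Fin.zero (Fin.suc Fin.zero) (s≤s z≤n))

module Redirect (k m : ℕ) where

  redirect : List ℕ → List ℕ
  redirect []          = []
  redirect (x ∷ [])    with x ≟ k
  ... | yes _ = m ∷ []
  ... | no  _ = x ∷ []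
  redirect (x ∷ y ∷ l) = x ∷ y ∷ redirect l

  alternating-redirect : ∀ d → d k ≤ d m → ∀ l → alternating d l ≤ alternating d (redirect l)
  alternating-redirect d dk≤dm []          = ℤP.≤-refl
  alternating-redirect d dk≤dm (x ∷ [])    with x ≟ k
  ... | yes refl = ℤP.*-monoˡ-≤-nonNeg (+ 2) dk≤dm
  ... | no  _    = ℤP.≤-refl
  alternating-redirect d dk≤dm (x ∷ y ∷ l) = ℤP.+-monoʳ-≤ (d x - d y) (alternating-redirect d dk≤dm l)

  redirect-indexList : k ℕ.< m → ∀ {Allowed} → Allowed m → ∀ {l} →
    IndexList Allowed U l → IndexList Allowed (λ x → ¬ x ≡ k) (redirect l)
  redirect-indexList k<m {Allowed} allowed-m {l} indices = record
    { oddWithLast = odd oddWithLast ; increasing = linked l increasing ; allowed = all allowed }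
    where
    open IndexList indices
    odd : ∀ {l} → OddWithLast U l → OddWithLast (λ x → ¬ x ≡ k) (redirect l)
    odd (single {x} _) with x ≟ k
    ... | yes _   = single (λ m≡k → ℕP.<-irrefl (sym m≡k) k<m)
    ... | no  x≢k = single x≢k
    odd (cons₂ rest) = cons₂ (odd rest)
    linked : ∀ {lo} l → Linked ℕ._<_ (lo ∷ l) → Linked ℕ._<_ (lo ∷ redirect l)
    linked []          [-]                 = [-]
    linked (x ∷ [])    (lo<x ∷ [-])        with x ≟ k
    ... | yes refl = ℕP.<-trans lo<x k<m ∷ [-]
    ... | no  _    = lo<x ∷ [-]
    linked (x ∷ y ∷ l) (lo<x ∷ x<y ∷ rest) = lo<x ∷ x<y ∷ linked l rest
    all : ∀ {l} → All Allowed l → All Allowed (redirect l)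
    all {[]}        []                = []
    all {x ∷ []}    (Px ∷ [])         with x ≟ k
    ... | yes _ = allowed-m ∷ []
    ... | no  _ = Px ∷ []
    all {x ∷ y ∷ l} (Px ∷ Py ∷ rest) = Px ∷ Py ∷ all rest

data ℤ₋∞ : Set where
  -∞  : ℤ₋∞
  fin : ℤ → ℤ₋∞

infixr 6 _⊔∞_
infixr 7 _+∞_
infix 4 _≤∞_ _≤∞ᵇ_

_⊔∞_ : ℤ₋∞ → ℤ₋∞ → ℤ₋∞
-∞    ⊔∞ y     = y
fin x ⊔∞ -∞    = fin x
fin x ⊔∞ fin y = fin (x ⊔ y)

_+∞_ : ℤ → ℤ₋∞ → ℤ₋∞
g +∞ -∞    = -∞
g +∞ fin x = fin (g + x)

data _≤∞_ : ℤ₋∞ → ℤ₋∞ → Set where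
  -∞≤   : ∀ {y} → -∞ ≤∞ y
  fin≤  : ∀ {x y} → x ≤ y → fin x ≤∞ fin y

_≤∞ᵇ_ : ℤ₋∞ → ℤ₋∞ → Bool
-∞    ≤∞ᵇ _     = true
fin _ ≤∞ᵇ -∞    = false
fin x ≤∞ᵇ fin y = x ≤ᵇ y

≤∞ᵇ⇒≤∞ : ∀ x y → T (x ≤∞ᵇ y) → x ≤∞ y
≤∞ᵇ⇒≤∞ -∞      y       _ = -∞≤
≤∞ᵇ⇒≤∞ (fin x) (fin y) p = fin≤ (ℤP.≤ᵇ⇒≤ p)

≤∞-trans : ∀ {x y z} → x ≤∞ y → y ≤∞ z → x ≤∞ z
≤∞-trans -∞≤      _        = -∞≤
≤∞-trans (fin≤ p) (fin≤ q) = fin≤ (ℤP.≤-trans p q)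

≤∞-refl : ∀ {x} → x ≤∞ x
≤∞-refl { -∞}  = -∞≤
≤∞-refl {fin x} = fin≤ ℤP.≤-refl

≤∞-reflexive : ∀ {x y} → x ≡ y → x ≤∞ y
≤∞-reflexive refl = ≤∞-refl

x≤x⊔∞y : ∀ x y → x ≤∞ x ⊔∞ y
x≤x⊔∞y -∞      y       = -∞≤
x≤x⊔∞y (fin x) -∞      = fin≤ ℤP.≤-refl
x≤x⊔∞y (fin x) (fin y) = fin≤ (ℤP.i≤i⊔j x y)

y≤x⊔∞y : ∀ x y → y ≤∞ x ⊔∞ y
y≤x⊔∞y -∞      -∞      = -∞≤
y≤x⊔∞y -∞      (fin y) = fin≤ ℤP.≤-refl
y≤x⊔∞y (fin x) -∞      = -∞≤
y≤x⊔∞y (fin x) (fin y) = fin≤ (ℤP.i≤j⊔i x y)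

+∞-monoʳ : ∀ g {x y} → x ≤∞ y → g +∞ x ≤∞ g +∞ y
+∞-monoʳ g -∞≤      = -∞≤
+∞-monoʳ g (fin≤ p) = fin≤ (ℤP.+-monoʳ-≤ g p)

-- The phase of an alternating sum: its next index enters with sign +, with sign −, or the
-- final index (weight 2) has already been read.
data Phase : Set where
  pos neg done : Phase

weight : Phase → Phase → ℤ
weight pos neg  = 1ℤ
weight pos done = + 2
weight neg pos  = -1ℤ
weight _   _    = 0ℤ

move : (allowed endAllowed : Bool) → Phase → Phase → Bool
move al el pos  pos  = true
move al el neg  neg  = true
move al el done done = true
move al el pos  neg  = al
move al el neg  pos  = al
move al el pos  done = al ∧ el
move al el _    _    = false

data Region : Set where
  firstRow midLow kthRow midHigh lastRow outside : Region

usesI usesK upToK mayEndI : Region → Bool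
usesI firstRow = true
usesI midLow   = true
usesI kthRow   = true
usesI lastRow  = true
usesI _        = false
usesK firstRow = true
usesK midHigh  = true
usesK lastRow  = true
usesK _        = false
upToK firstRow = true
upToK midLow   = true
upToK kthRow   = true
upToK _        = false
mayEndI kthRow = false
mayEndI _      = true

rowOK : Region → (reachesK inside cell : Bool) → Bool
rowOK firstRow fl a b = a ∧ b
rowOK kthRow   fl a b = if a then fl else not fl
rowOK lastRow  fl a b = not a ∧ not b
rowOK _        fl a b = true

-- Σ_{i ≤ k} (a_i − f_i) counts the holes (a ∧ ¬f) in the rows up to k if the column reaches
-- row k, and the overflows (¬a ∧ f) in the rows below k otherwise.
σ-cell : (reachesK upToK inside cell : Bool) → Bool
σ-cell true  true  a b = a ∧ not b
σ-cell false false a b = not a ∧ b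
σ-cell _     _     a b = false

record State : Set where
  constructor state
  field
    prevCell prevInside : Bool
    phaseI phaseK : Phase
    reachesK seenHole seenOverflow : Bool

open State

indDiff : Bool → Bool → ℤ
indDiff a b = + ind a - + ind b

gain : Region → State → (inside cell : Bool) → (phaseI′ phaseK′ : Phase) → ℤ
gain R s a b sI sK =
  weight (phaseI s) sI * indDiff a b + weight (phaseK s) sK * indDiff a b
  - + ind (prevCell s xor b) - + ind (σ-cell (reachesK s) (upToK R) a b)

admissible : Region → State → (inside cell : Bool) → (phaseI′ phaseK′ : Phase) → Bool
admissible R s a b sI sK =
  (not a ∨ prevInside s) ∧ rowOK R (reachesK s) a b
  ∧ move (usesI R) (mayEndI R) (phaseI s) sI ∧ move (usesK R) true (phaseK s) sK

next : State → (inside cell : Bool) → (phaseI′ phaseK′ : Phase) → State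
next s a b sI sK =
  state b a sI sK (reachesK s) (seenHole s ∨ (a ∧ not b)) (seenOverflow s ∨ (not a ∧ b))

⨆Bool : (Bool → ℤ₋∞) → ℤ₋∞
⨆Bool g = g true ⊔∞ g false

⨆Phase : (Phase → ℤ₋∞) → ℤ₋∞
⨆Phase g = g pos ⊔∞ g neg ⊔∞ g done

bestMove : Region → (State → ℤ₋∞) → State → ℤ₋∞
bestMove R ψ s = ⨆Bool λ a → ⨆Bool λ b → ⨆Phase λ sI → ⨆Phase λ sK →
  if admissible R s a b sI sK then gain R s a b sI sK +∞ ψ (next s a b sI sK) else -∞

⨆Bool-≥ : ∀ g b → g b ≤∞ ⨆Bool g
⨆Bool-≥ g true  = x≤x⊔∞y (g true) (g false)
⨆Bool-≥ g false = y≤x⊔∞y (g true) (g false)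

⨆Phase-≥ : ∀ g p → g p ≤∞ ⨆Phase g
⨆Phase-≥ g pos  = x≤x⊔∞y (g pos) (g neg ⊔∞ g done)
⨆Phase-≥ g neg  = ≤∞-trans (x≤x⊔∞y (g neg) (g done)) (y≤x⊔∞y (g pos) (g neg ⊔∞ g done))
⨆Phase-≥ g done = ≤∞-trans (y≤x⊔∞y (g neg) (g done)) (y≤x⊔∞y (g pos) (g neg ⊔∞ g done))

bestMove-≥ : ∀ R ψ s a b sI sK → T (admissible R s a b sI sK) →
  gain R s a b sI sK +∞ ψ (next s a b sI sK) ≤∞ bestMove R ψ s
bestMove-≥ R ψ s a b sI sK adm =
  subst (_≤∞ bestMove R ψ s) chosen
  (≤∞-trans (⨆Phase-≥ (candidate a b sI) sK)
  (≤∞-trans (⨆Phase-≥ (λ sI → ⨆Phase (candidate a b sI)) sI)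
  (≤∞-trans (⨆Bool-≥ (λ b → ⨆Phase λ sI → ⨆Phase (candidate a b sI)) b)
            (⨆Bool-≥ (λ a → ⨆Bool λ b → ⨆Phase λ sI → ⨆Phase (candidate a b sI)) a))))
  where
  candidate : Bool → Bool → Phase → Phase → ℤ₋∞
  candidate a b sI sK =
    if admissible R s a b sI sK then gain R s a b sI sK +∞ ψ (next s a b sI sK) else -∞
  chosen : candidate a b sI sK ≡ gain R s a b sI sK +∞ ψ (next s a b sI sK)
  chosen rewrite Equivalence.to T-≡ adm = refl

potentialOutside : State → ℤ₋∞
potentialOutside (state _ _ done done _ true  true ) = fin 0ℤ
potentialOutside (state _ _ done done _ false false) = fin 0ℤ
potentialOutside _                                   = -∞

potentialLast : State → ℤ₋∞
potentialLast = bestMove lastRow potentialOutside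

-- On the two regions that a column may traverse for arbitrarily many rows, the potential is
-- given by its values (computed by value iteration); that they satisfy the Bellman inequality
-- is checked below by evaluation on all states.
middleHigh : State → ℤ₋∞
middleHigh (state _     _     neg _    _     _     _    ) = -∞
middleHigh (state false _     _   _    _     false false) = fin 0ℤ
middleHigh (state true  _     _   _    _     false false) = fin -1ℤ
middleHigh (state _     false _   pos  false true  false) = fin (- + 2)
middleHigh (state _     false _   pos  true  true  false) = fin -1ℤ
middleHigh (state _     true  _   pos  false true  false) = fin -1ℤ
middleHigh (state _     true  _   pos  true  true  false) = fin 0ℤ
middleHigh (state false _     _   neg  false true  false) = fin (- + 2)
middleHigh (state false _     _   neg  true  true  false) = fin -1ℤ
middleHigh (state true  _     _   neg  false true  false) = fin -1ℤ
middleHigh (state true  _     _   neg  true  true  false) = fin 0ℤ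
middleHigh (state false _     _   done false true  false) = fin (- + 3)
middleHigh (state false _     _   done true  true  false) = fin (- + 2)
middleHigh (state true  _     _   done false true  false) = fin (- + 2)
middleHigh (state true  _     _   done true  true  false) = fin -1ℤ
middleHigh (state false false _   _    _     true  true ) = fin 0ℤ
middleHigh (state true  false _   pos  _     true  true ) = fin -1ℤ
middleHigh (state true  false _   neg  false true  true ) = fin -1ℤ
middleHigh (state true  false _   neg  true  true  true ) = fin 0ℤ
middleHigh (state true  false _   done _     true  true ) = fin -1ℤ
middleHigh (state false true  _   pos  _     _     true ) = fin (+ 2)
middleHigh (state true  true  _   pos  _     _     true ) = fin 1ℤ
middleHigh (state _     true  _   neg  _     _     true ) = fin 1ℤ
middleHigh (state false true  _   done _     _     true ) = fin 0ℤ
middleHigh (state true  true  _   done _     _     true ) = fin -1ℤ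
middleHigh _ = -∞

potentialK : State → ℤ₋∞
potentialK s = bestMove kthRow middleHigh s ⊔∞ bestMove kthRow potentialLast s

middleLow : State → ℤ₋∞
middleLow (state false _     _    _    false false false) = fin 0ℤ
middleLow (state true  _     _    _    false false false) = fin -1ℤ
middleLow (state _     false pos  _    false true  false) = fin -1ℤ
middleLow (state _     true  pos  _    false true  false) = fin 0ℤ
middleLow (state false _     neg  _    false true  false) = fin -1ℤ
middleLow (state true  _     neg  _    false true  false) = fin 0ℤ
middleLow (state false _     done _    false true  false) = fin (- + 2)
middleLow (state true  _     done _    false true  false) = fin -1ℤ
middleLow (state false false _    _    false true  true ) = fin 0ℤ
middleLow (state true  false pos  _    false true  true ) = fin -1ℤ
middleLow (state true  false neg  _    false true  true ) = fin 0ℤ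
middleLow (state true  false done _    false true  true ) = fin -1ℤ
middleLow (state false true  pos  _    false _     true ) = fin (+ 2)
middleLow (state true  true  pos  _    false _     true ) = fin 1ℤ
middleLow (state _     true  neg  _    false _     true ) = fin 1ℤ
middleLow (state false true  done _    false _     true ) = fin 0ℤ
middleLow (state true  true  done _    false _     true ) = fin -1ℤ
middleLow (state false true  pos  pos  true  _     false) = fin 0ℤ
middleLow (state false true  pos  pos  true  _     true ) = fin (+ 2)
middleLow (state false true  pos  neg  true  _     false) = fin 0ℤ
middleLow (state false true  pos  neg  true  _     true ) = fin 1ℤ
middleLow (state false true  pos  done true  _     false) = fin -1ℤ
middleLow (state false true  pos  done true  _     true ) = fin 0ℤ
middleLow (state false true  neg  pos  true  false false) = fin (- + 2)
middleLow (state false true  neg  pos  true  true  false) = fin -1ℤ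
middleLow (state false true  neg  pos  true  _     true ) = fin 0ℤ
middleLow (state false true  neg  neg  true  false false) = fin (- + 2)
middleLow (state false true  neg  neg  true  true  false) = fin -1ℤ
middleLow (state false true  neg  neg  true  _     true ) = fin 0ℤ
middleLow (state false true  neg  done true  _     _    ) = fin (- + 2)
middleLow (state false true  done pos  true  false false) = fin (- + 2)
middleLow (state false true  done pos  true  true  false) = fin -1ℤ
middleLow (state false true  done pos  true  _     true ) = fin 0ℤ
middleLow (state false true  done neg  true  false false) = fin (- + 2)
middleLow (state false true  done neg  true  true  false) = fin -1ℤ
middleLow (state false true  done neg  true  _     true ) = fin 0ℤ
middleLow (state false true  done done true  _     _    ) = fin (- + 2)
middleLow (state true  true  _    pos  true  false false) = fin -1ℤ
middleLow (state true  true  _    pos  true  true  false) = fin 0ℤ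
middleLow (state true  true  _    pos  true  _     true ) = fin 1ℤ
middleLow (state true  true  _    neg  true  false false) = fin -1ℤ
middleLow (state true  true  _    neg  true  true  false) = fin 0ℤ
middleLow (state true  true  _    neg  true  _     true ) = fin 1ℤ
middleLow (state true  true  _    done true  _     _    ) = fin -1ℤ
middleLow _ = -∞

potentialFirst : State → ℤ₋∞
potentialFirst s = bestMove firstRow middleLow s ⊔∞ bestMove firstRow potentialK s

potential : Region → State → ℤ₋∞
potential firstRow = potentialFirst
potential midLow   = middleLow
potential kthRow   = potentialK
potential midHigh  = middleHigh
potential lastRow  = potentialLast
potential outside  = potentialOutside

potential-start : ∀ fl → potential firstRow (state false true pos pos fl false false) ≡ fin (- + 2)
potential-start true  = refl
potential-start false = refl

outside-balanced : ∀ pb pa fl h → potential outside (state pb pa done done fl h h) ≡ fin 0ℤ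
outside-balanced pb pa fl true  = refl
outside-balanced pb pa fl false = refl

allBool : (Bool → Bool) → Bool
allBool P = P true ∧ P false

allPhase : (Phase → Bool) → Bool
allPhase P = P pos ∧ P neg ∧ P done

allStates : (State → Bool) → Bool
allStates P =
  allBool λ pb → allBool λ pa → allPhase λ sI → allPhase λ sK →
  allBool λ fl → allBool λ h → allBool λ o → P (state pb pa sI sK fl h o)

allBool-sound : ∀ {P} → T (allBool P) → ∀ b → T (P b)
allBool-sound {P} t true  = proj₁ (Equivalence.to (T-∧ {P true}) t)
allBool-sound {P} t false = proj₂ (Equivalence.to (T-∧ {P true}) t)

allPhase-sound : ∀ {P} → T (allPhase P) → ∀ p → T (P p)
allPhase-sound {P} t pos  = proj₁ (Equivalence.to (T-∧ {P pos}) t)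
allPhase-sound {P} t neg  = proj₁ (Equivalence.to (T-∧ {P neg}) (proj₂ (Equivalence.to (T-∧ {P pos}) t)))
allPhase-sound {P} t done = proj₂ (Equivalence.to (T-∧ {P neg}) (proj₂ (Equivalence.to (T-∧ {P pos}) t)))

allStates-sound : ∀ {P} → T (allStates P) → ∀ s → T (P s)
allStates-sound {P} t (state pb pa sI sK fl h o) =
  allBool-sound {λ o → P (state pb pa sI sK fl h o)}
  (allBool-sound {λ h → allBool λ o → P (state pb pa sI sK fl h o)}
  (allBool-sound {λ fl → allBool λ h → allBool λ o → P (state pb pa sI sK fl h o)}
  (allPhase-sound {λ sK → allBool λ fl → allBool λ h → allBool λ o → P (state pb pa sI sK fl h o)}
  (allPhase-sound {λ sI → allPhase λ sK → allBool λ fl → allBool λ h → allBool λ o →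
                     P (state pb pa sI sK fl h o)}
  (allBool-sound {λ pa → allPhase λ sI → allPhase λ sK → allBool λ fl → allBool λ h → allBool λ o →
                    P (state pb pa sI sK fl h o)}
  (allBool-sound {λ pb → allBool λ pa → allPhase λ sI → allPhase λ sK → allBool λ fl → allBool λ h →
                    allBool λ o → P (state pb pa sI sK fl h o)}
  t pb) pa) sI) sK) fl) h) o

middleLow-dominates : ∀ s → bestMove midLow middleLow s ⊔∞ bestMove midLow potentialK s ≤∞ middleLow s
middleLow-dominates s = ≤∞ᵇ⇒≤∞ _ _ (allStates-sound {check} tt s)
  where
  check : State → Bool
  check s = bestMove midLow middleLow s ⊔∞ bestMove midLow potentialK s ≤∞ᵇ middleLow s

middleHigh-dominates : ∀ s →
  bestMove midHigh middleHigh s ⊔∞ bestMove midHigh potentialLast s ≤∞ middleHigh s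
middleHigh-dominates s = ≤∞ᵇ⇒≤∞ _ _ (allStates-sound {check} tt s)
  where
  check : State → Bool
  check s = bestMove midHigh middleHigh s ⊔∞ bestMove midHigh potentialLast s ≤∞ᵇ middleHigh s

infix 4 _⟶_

data _⟶_ : Region → Region → Set where
  first→low  : firstRow ⟶ midLow
  first→k    : firstRow ⟶ kthRow
  low→low    : midLow   ⟶ midLow
  low→k      : midLow   ⟶ kthRow
  k→high     : kthRow   ⟶ midHigh
  k→last     : kthRow   ⟶ lastRow
  high→high  : midHigh  ⟶ midHigh
  high→last  : midHigh  ⟶ lastRow
  last→out   : lastRow  ⟶ outside

bestMove-≤-potential : ∀ {R R'} → R ⟶ R' → ∀ s → bestMove R (potential R') s ≤∞ potential R s
bestMove-≤-potential first→low s = x≤x⊔∞y _ _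
bestMove-≤-potential first→k   s = y≤x⊔∞y (bestMove firstRow middleLow s) _
bestMove-≤-potential low→low   s = ≤∞-trans (x≤x⊔∞y _ _) (middleLow-dominates s)
bestMove-≤-potential low→k     s = ≤∞-trans (y≤x⊔∞y (bestMove midLow middleLow s) _) (middleLow-dominates s)
bestMove-≤-potential k→high    s = x≤x⊔∞y _ _
bestMove-≤-potential k→last    s = y≤x⊔∞y (bestMove kthRow middleHigh s) _
bestMove-≤-potential high→high s = ≤∞-trans (x≤x⊔∞y _ _) (middleHigh-dominates s)
bestMove-≤-potential high→last s = ≤∞-trans (y≤x⊔∞y (bestMove midHigh middleHigh s) _) (middleHigh-dominates s)
bestMove-≤-potential last→out  s = ≤∞-refl

move-≤-potential : ∀ {R R'} → R ⟶ R' → ∀ s a b sI sK → T (admissible R s a b sI sK) →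
  gain R s a b sI sK +∞ potential R' (next s a b sI sK) ≤∞ potential R s
move-≤-potential {R} {R'} edge s a b sI sK adm =
  ≤∞-trans (bestMove-≥ R (potential R') s a b sI sK adm) (bestMove-≤-potential edge s)

data Pending (Q : ℕ → Set) : Phase → List ℕ → Set where
  pos  : ∀ {l} → OddWithLast Q l → Pending Q pos l
  neg  : ∀ {y l} → OddWithLast Q l → Pending Q neg (y ∷ l)
  done : Pending Q done []

remaining : (ℕ → ℤ) → Phase → List ℕ → ℤ
remaining d pos  l       = alternating d l
remaining d neg  []      = 0ℤ
remaining d neg  (y ∷ l) = - d y + alternating d l
remaining d done _       = 0ℤ

finished : ∀ {Q s} → Pending Q s [] → s ≡ done
finished done = refl

T-∧-intro : ∀ {x y} → T x → T y → T (x ∧ y)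
T-∧-intro p q = Equivalence.from T-∧ (p , q)

record Advance (P Q : ℕ → Set) (al el : Bool) (d : ℕ → ℤ) (r : ℕ) (s : Phase) (l : List ℕ) : Set where
  field
    phase   : Phase
    rest    : List ℕ
    split   : remaining d s l ≡ weight s phase * d r + remaining d phase rest
    pending : Pending Q phase rest
    linked  : Linked ℕ._<_ (r ∷ rest)
    allowed : All P rest
    legal   : T (move al el s phase)

module _ {P Q : ℕ → Set} {al el : Bool} (d : ℕ → ℤ) where

  stay : ∀ {r s l} → Pending Q s l → Linked ℕ._<_ (r ∷ l) → All P l → Advance P Q al el d r s l
  stay {r} {s} {l} pend lk all = record
    { phase = s ; rest = l ; split = unchanged s ; pending = pend ; linked = lk ; allowed = all
    ; legal = move-refl s }
    where
    unchanged : ∀ s → remaining d s l ≡ weight s s * d r + remaining d s l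
    unchanged pos  = sym (ℤP.+-identityˡ _)
    unchanged neg  = sym (ℤP.+-identityˡ _)
    unchanged done = sym (ℤP.+-identityˡ _)
    move-refl : ∀ s → T (move al el s s)
    move-refl pos  = _
    move-refl neg  = _
    move-refl done = _

  advance : ∀ {i s l} → (P (suc i) → T al) → (Q (suc i) → T el) →
    Pending Q s l → Linked ℕ._<_ (i ∷ l) → All P l → Advance P Q al el d (suc i) s l
  advance {i} al? el? done [-] [] = stay done [-] []
  advance {i} al? el? (neg {y} {l} odd) (i<y ∷ lk) (Py ∷ all) with y ≟ suc i
  ... | yes refl = record
    { phase = pos ; rest = l ; split = cong (_+ alternating d l) (sym (ℤP.-1*i≡-i (d y)))
    ; pending = pos odd ; linked = lk ; allowed = all ; legal = al? Py }
  ... | no y≢r = stay (neg odd) (ℕP.≤∧≢⇒< i<y (λ r≡y → y≢r (sym r≡y)) ∷ lk) (Py ∷ all)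
  advance {i} al? el? (pos (single {x} Qx)) (i<x ∷ [-]) (Px ∷ []) with x ≟ suc i
  ... | yes refl = record
    { phase = done ; rest = [] ; split = sym (ℤP.+-identityʳ _)
    ; pending = done ; linked = [-] ; allowed = [] ; legal = T-∧-intro (al? Px) (el? Qx) }
  ... | no x≢r = stay (pos (single Qx)) (ℕP.≤∧≢⇒< i<x (λ r≡x → x≢r (sym r≡x)) ∷ [-]) (Px ∷ [])
  advance {i} al? el? (pos (cons₂ {x} {y} {l} odd)) (i<x ∷ lk) (Px ∷ all) with x ≟ suc i
  ... | yes refl = record
    { phase = neg ; rest = y ∷ l ; split = regroup (d x) (d y) (alternating d l)
    ; pending = neg odd ; linked = lk ; allowed = all ; legal = al? Px }
    where
    regroup : ∀ a b c → a - b + c ≡ 1ℤ * a + (- b + c)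
    regroup = solve-∀
  ... | no x≢r = stay (pos (cons₂ odd)) (ℕP.≤∧≢⇒< i<x (λ r≡x → x≢r (sym r≡x)) ∷ lk) (Px ∷ all)

RowsI RowsK : ℕ → ℕ → ℕ → Set
RowsI k m r = (1 ℕ.≤ r × r ℕ.≤ k) ⊎ r ≡ m
RowsK k m r = r ≡ 1 ⊎ (suc k ℕ.≤ r × r ℕ.≤ m)

RowsI-positive : ∀ {k m x} → 0 ℕ.< m → RowsI k m x → 0 ℕ.< x
RowsI-positive _   (inj₁ (1≤x , _)) = 1≤x
RowsI-positive 0<m (inj₂ refl)      = 0<m

RowsK-positive : ∀ {k m x} → RowsK k m x → 0 ℕ.< x
RowsK-positive (inj₁ refl)      = s≤s z≤n
RowsK-positive (inj₂ (k<x , _)) = ℕP.≤-trans (s≤s z≤n) k<x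

module Column (m k : ℕ) (cell : ℕ → Bool) (2≤k : 2 ℕ.≤ k) (k<m : k ℕ.< m)
              (cell-0 : cell 0 ≡ false) (cell-1 : cell 1 ≡ true)
              (cell-m : cell m ≡ false) where

  NotK : ℕ → Set
  NotK r = ¬ r ≡ k

  height : ℕ
  height = sumTo m (λ i → ind (cell i))

  inside : ℕ → Bool
  inside i = i ℕ.≤ᵇ height

  excess : ℕ → ℤ
  excess i = indDiff (inside i) (cell i)

  boundary : ℕ
  boundary = sumTo m (λ i → if cell i then ind (not (cell (i ℕ.∸ 1))) ℕ.+ ind (not (cell (suc i))) else 0)

  heightReachesK : Bool
  heightReachesK = k ℕ.≤ᵇ height

  holeBy overflowBy : ℕ → Bool
  holeBy zero        = false
  holeBy (suc i)     = holeBy i ∨ (inside (suc i) ∧ not (cell (suc i)))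
  overflowBy zero    = false
  overflowBy (suc i) = overflowBy i ∨ (not (inside (suc i)) ∧ cell (suc i))

  changed σ-part : ℕ → ℕ
  changed r = ind (cell (r ℕ.∸ 1) xor cell r)
  σ-part  r = ind (σ-cell heightReachesK (r ℕ.≤ᵇ k) (inside r) (cell r))

  rowTerm : ℕ → ℤ
  rowTerm r = - + changed r - + σ-part r

  stateAt : ℕ → Phase → Phase → State
  stateAt i sI sK = state (cell i) (inside i) sI sK heightReachesK (holeBy i) (overflowBy i)

  1≤m : 1 ℕ.≤ m
  1≤m = ℕP.≤-trans (s≤s z≤n) k<m

  1≤height : 1 ℕ.≤ height
  1≤height = subst (λ b → ind b ℕ.≤ height) cell-1 (term-≤-sumTo m (λ i → ind (cell i)) ℕP.≤-refl 1≤m)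

  height<m : height ℕ.< m
  height<m = sumTo-ind-< m cell 1≤m cell-m

  inside-true : ∀ {r} → r ℕ.≤ height → inside r ≡ true
  inside-true = ≤ᵇ-true

  inside-false : ∀ {r} → height ℕ.< r → inside r ≡ false
  inside-false = ≤ᵇ-false

  inside-antitone : ∀ i → T (not (inside (suc i)) ∨ inside i)
  inside-antitone i with suc i ℕ.≤? height
  ... | yes i<h rewrite inside-true i<h | inside-true (ℕP.<⇒≤ i<h) = _
  ... | no  i≮h rewrite inside-false (ℕP.≰⇒> i≮h) = _

  sum-excess : sumToℤ m excess ≡ 0ℤ
  sum-excess = begin
    sumToℤ m excess
      ≡⟨ sumToℤ-distrib-- m _ _ ⟩
    sumToℤ m (λ i → + ind (inside i)) - sumToℤ m (λ i → + ind (cell i))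
      ≡⟨ cong₂ _-_ (sym (+-sumTo m _)) (sym (+-sumTo m _)) ⟩
    + sumTo m (λ i → ind (inside i)) - + height
      ≡⟨ cong (λ x → + x - + height)
              (trans (sumTo-≤ᵇ m height) (ℕP.m≥n⇒m⊓n≡n (ℕP.<⇒≤ height<m))) ⟩
    + height - + height
      ≡⟨ ℤP.+-inverseʳ (+ height) ⟩
    0ℤ ∎
    where open ≡-Reasoning

  boundary-changes : boundary ≡ sumTo m changed
  boundary-changes =
    trans (up-to m) (trans (cong (λ b → sumTo m changed ℕ.+ ind (b ∧ not (cell (suc m)))) cell-m)
                           (ℕP.+-identityʳ _))
    where
    step : ∀ p q w → ind (p ∧ not q) ℕ.+ (if q then ind (not p) ℕ.+ ind (not w) else 0)
                     ≡ ind (p xor q) ℕ.+ ind (q ∧ not w)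
    step true  true  true  = refl
    step true  true  false = refl
    step true  false _     = refl
    step false true  true  = refl
    step false true  false = refl
    step false false _     = refl
    up-to : ∀ n → sumTo n (λ i → if cell i then ind (not (cell (i ℕ.∸ 1))) ℕ.+ ind (not (cell (suc i))) else 0)
                  ≡ sumTo n changed ℕ.+ ind (cell n ∧ not (cell (suc n)))
    up-to zero    rewrite cell-0 = refl
    up-to (suc n) rewrite up-to n =
      trans (ℕP.+-assoc (sumTo n changed) _ _)
            (trans (cong (sumTo n changed ℕ.+_) (step (cell n) (cell (suc n)) (cell (suc (suc n)))))
                   (sym (ℕP.+-assoc (sumTo n changed) _ _)))

  σ-part-reaching : k ℕ.≤ height → ∀ r → + σ-part r ≡ (if r ℕ.≤ᵇ k then excess r else 0ℤ)
  σ-part-reaching k≤h r with r ℕ.≤? k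
  ... | yes r≤k rewrite ≤ᵇ-true k≤h | ≤ᵇ-true r≤k | inside-true (ℕP.≤-trans r≤k k≤h) = hole (cell r)
    where
    hole : ∀ b → + ind (not b) ≡ indDiff true b
    hole true  = refl
    hole false = refl
  ... | no  r≰k rewrite ≤ᵇ-true k≤h | ≤ᵇ-false {r} (ℕP.≰⇒> r≰k) = refl

  σ-part-short : height ℕ.< k → ∀ r → + σ-part r ≡ (if r ℕ.≤ᵇ k then 0ℤ else - excess r)
  σ-part-short h<k r with r ℕ.≤? k
  ... | yes r≤k rewrite ≤ᵇ-false h<k | ≤ᵇ-true r≤k = refl
  ... | no  r≰k rewrite ≤ᵇ-false h<k | ≤ᵇ-false {r} (ℕP.≰⇒> r≰k)
                      | inside-false (ℕP.<-trans h<k (ℕP.≰⇒> r≰k)) = overflow (cell r)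
    where
    overflow : ∀ b → + ind b ≡ - indDiff false b
    overflow true  = refl
    overflow false = refl

  σ-sum : sumToℤ m (λ r → + σ-part r) ≡ sumToℤ k excess
  σ-sum with k ℕ.≤? height
  ... | yes k≤h =
    trans (sumToℤ-cong m (λ r _ _ → σ-part-reaching k≤h r)) (sumToℤ-truncate excess m (ℕP.<⇒≤ k<m))
  ... | no  k≰h = begin
    sumToℤ m (λ r → + σ-part r)
      ≡⟨ sumToℤ-cong m (λ r _ _ → trans (σ-part-short (ℕP.≰⇒> k≰h) r) (split r)) ⟩
    sumToℤ m (λ r → (if r ℕ.≤ᵇ k then excess r else 0ℤ) - excess r)
      ≡⟨ sumToℤ-distrib-- m _ excess ⟩
    sumToℤ m (λ r → if r ℕ.≤ᵇ k then excess r else 0ℤ) - sumToℤ m excess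
      ≡⟨ cong₂ _-_ (sumToℤ-truncate excess m (ℕP.<⇒≤ k<m)) sum-excess ⟩
    sumToℤ k excess - 0ℤ
      ≡⟨ ℤP.+-identityʳ _ ⟩
    sumToℤ k excess ∎
    where
    open ≡-Reasoning
    split : ∀ r → (if r ℕ.≤ᵇ k then 0ℤ else - excess r)
                  ≡ (if r ℕ.≤ᵇ k then excess r else 0ℤ) - excess r
    split r with r ℕ.≤ᵇ k
    ... | true  = sym (ℤP.+-inverseʳ (excess r))
    ... | false = sym (ℤP.+-identityˡ (- excess r))

  rowTerm-sum : sumToℤ m rowTerm ≡ - + boundary - sumToℤ k excess
  rowTerm-sum = begin
    sumToℤ m rowTerm
      ≡⟨ sumToℤ-distrib-- m (λ r → - + changed r) (λ r → + σ-part r) ⟩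
    sumToℤ m (λ r → - + changed r) - sumToℤ m (λ r → + σ-part r)
      ≡⟨ cong₂ _-_ (sumToℤ-neg m (λ r → + changed r)) σ-sum ⟩
    - sumToℤ m (λ r → + changed r) - sumToℤ k excess
      ≡⟨ cong (λ x → - x - sumToℤ k excess) (sym (trans (cong +_ boundary-changes) (+-sumTo m changed))) ⟩
    - + boundary - sumToℤ k excess ∎
    where open ≡-Reasoning

  hole-bound : ∀ n → overflowBy n ≡ false → + ind (holeBy n) ≤ sumToℤ n excess
  hole-bound zero    _     = ℤP.≤-refl
  hole-bound (suc n) no-ov with overflowBy n in ov
  ... | false = ℤP.≤-trans (step (holeBy n) (inside (suc n)) (cell (suc n)) no-ov)
                           (ℤP.+-monoˡ-≤ (excess (suc n)) (hole-bound n ov))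
    where
    step : ∀ h a b → (not a ∧ b) ≡ false → + ind (h ∨ (a ∧ not b)) ≤ + ind h + indDiff a b
    step true  true  true  _ = ℤP.≤ᵇ⇒≤ _
    step true  true  false _ = ℤP.≤ᵇ⇒≤ _
    step true  false false _ = ℤP.≤ᵇ⇒≤ _
    step false true  true  _ = ℤP.≤ᵇ⇒≤ _
    step false true  false _ = ℤP.≤ᵇ⇒≤ _
    step false false false _ = ℤP.≤ᵇ⇒≤ _

  overflow-bound : ∀ n → holeBy n ≡ false → sumToℤ n excess ≤ - + ind (overflowBy n)
  overflow-bound zero    _       = ℤP.≤-refl
  overflow-bound (suc n) no-hole with holeBy n in hl
  ... | false = ℤP.≤-trans (ℤP.+-monoˡ-≤ (excess (suc n)) (overflow-bound n hl))
                           (step (overflowBy n) (inside (suc n)) (cell (suc n)) no-hole)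
    where
    step : ∀ o a b → (a ∧ not b) ≡ false → - + ind o + indDiff a b ≤ - + ind (o ∨ (not a ∧ b))
    step true  true  true  _ = ℤP.≤ᵇ⇒≤ _
    step true  false true  _ = ℤP.≤ᵇ⇒≤ _
    step true  false false _ = ℤP.≤ᵇ⇒≤ _
    step false true  true  _ = ℤP.≤ᵇ⇒≤ _
    step false false true  _ = ℤP.≤ᵇ⇒≤ _
    step false false false _ = ℤP.≤ᵇ⇒≤ _

  hole⇔overflow : holeBy m ≡ overflowBy m
  hole⇔overflow with holeBy m in hl | overflowBy m in ov
  ... | true  | true  = refl
  ... | false | false = refl
  ... | true  | false with ℤP.≤-trans (hole-bound m ov) (ℤP.≤-reflexive sum-excess)
  ...   | bound rewrite hl = case bound of λ { (+≤+ ()) }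
  hole⇔overflow | false | true with ℤP.≤-trans (ℤP.≤-reflexive (sym sum-excess)) (overflow-bound m hl)
  ...   | bound rewrite ov = case bound of λ ()

  data RowView (r : ℕ) : Set where
    first : r ≡ 1 → RowView r
    low   : 1 ℕ.< r → r ℕ.< k → RowView r
    kth   : r ≡ k → RowView r
    high  : k ℕ.< r → r ℕ.< m → RowView r
    last  : r ≡ m → RowView r
    past  : m ℕ.< r → RowView r

  region : ∀ {r} → RowView r → Region
  region (first _)  = firstRow
  region (low _ _)  = midLow
  region (kth _)    = kthRow
  region (high _ _) = midHigh
  region (last _)   = lastRow
  region (past _)   = outside

  next-view : ∀ {r} (v : RowView r) → r ℕ.≤ m → Σ (RowView (suc r)) λ v' → region v ⟶ region v'
  next-view (first refl) _ with 2 ℕ.<? k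
  ... | yes 2<k = low ℕP.≤-refl 2<k , first→low
  ... | no  2≮k = kth (ℕP.≤-antisym 2≤k (ℕP.≮⇒≥ 2≮k)) , first→k
  next-view (low 1<r r<k) _ with suc _ ℕ.<? k
  ... | yes r+1<k = low (ℕP.m<n⇒m<1+n 1<r) r+1<k , low→low
  ... | no  r+1≮k = kth (ℕP.≤-antisym r<k (ℕP.≮⇒≥ r+1≮k)) , low→k
  next-view (kth refl) _ with suc k ℕ.<? m
  ... | yes k+1<m = high ℕP.≤-refl k+1<m , k→high
  ... | no  k+1≮m = last (ℕP.≤-antisym k<m (ℕP.≮⇒≥ k+1≮m)) , k→last
  next-view (high k<r r<m) _ with suc _ ℕ.<? m
  ... | yes r+1<m = high (ℕP.m<n⇒m<1+n k<r) r+1<m , high→high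
  ... | no  r+1≮m = last (ℕP.≤-antisym r<m (ℕP.≮⇒≥ r+1≮m)) , high→last
  next-view (last refl) _ = past ℕP.≤-refl , last→out
  next-view (past m<r) r≤m = ⊥-elim (ℕP.<⇒≱ m<r r≤m)

  usesI-view : ∀ {r} (v : RowView r) → RowsI k m r → T (usesI (region v))
  usesI-view (first _)     _                = _
  usesI-view (low _ _)     _                = _
  usesI-view (kth _)       _                = _
  usesI-view (high k<r _)  (inj₁ (_ , r≤k)) = ⊥-elim (ℕP.<⇒≱ k<r r≤k)
  usesI-view (high _ r<m)  (inj₂ refl)      = ⊥-elim (ℕP.<-irrefl refl r<m)
  usesI-view (last _)      _                = _
  usesI-view (past m<r)    (inj₁ (_ , r≤k)) = ⊥-elim (ℕP.<⇒≱ (ℕP.<-trans k<m m<r) r≤k)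
  usesI-view (past m<r)    (inj₂ refl)      = ⊥-elim (ℕP.<-irrefl refl m<r)

  usesK-view : ∀ {r} (v : RowView r) → RowsK k m r → T (usesK (region v))
  usesK-view (first _)     _                = _
  usesK-view (low 1<r _)   (inj₁ refl)      = ⊥-elim (ℕP.<-irrefl refl 1<r)
  usesK-view (low _ r<k)   (inj₂ (k<r , _)) = ⊥-elim (ℕP.<-asym k<r r<k)
  usesK-view (kth refl)    (inj₁ k≡1)       = ⊥-elim (ℕP.<⇒≢ 2≤k (sym k≡1))
  usesK-view (kth refl)    (inj₂ (k<k , _)) = ⊥-elim (ℕP.<-irrefl refl k<k)
  usesK-view (high _ _)    _                = _
  usesK-view (last _)      _                = _
  usesK-view (past m<r)    (inj₁ refl)      = ⊥-elim (ℕP.<⇒≱ m<r 1≤m)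
  usesK-view (past m<r)    (inj₂ (_ , r≤m)) = ⊥-elim (ℕP.<⇒≱ m<r r≤m)

  mayEndI-view : ∀ {r} (v : RowView r) → NotK r → T (mayEndI (region v))
  mayEndI-view (first _)  _   = _
  mayEndI-view (low _ _)  _   = _
  mayEndI-view (kth r≡k)  r≢k = ⊥-elim (r≢k r≡k)
  mayEndI-view (high _ _) _   = _
  mayEndI-view (last _)   _   = _
  mayEndI-view (past _)   _   = _

  rowOK-view : ∀ {r} (v : RowView r) → r ℕ.≤ m → T (rowOK (region v) heightReachesK (inside r) (cell r))
  rowOK-view (first refl) _ rewrite inside-true 1≤height | cell-1 = _
  rowOK-view (low _ _)    _ = _
  rowOK-view (kth refl)   _ with heightReachesK
  ... | true  = _
  ... | false = _
  rowOK-view (high _ _)   _ = _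
  rowOK-view (last refl)  _ rewrite inside-false height<m | cell-m = _
  rowOK-view (past m<r) r≤m = ⊥-elim (ℕP.<⇒≱ m<r r≤m)

  upToK-view : ∀ {r} (v : RowView r) → r ℕ.≤ m → upToK (region v) ≡ (r ℕ.≤ᵇ k)
  upToK-view (first refl)  _ = sym (≤ᵇ-true (ℕP.≤-trans (s≤s z≤n) 2≤k))
  upToK-view (low _ r<k)   _ = sym (≤ᵇ-true (ℕP.<⇒≤ r<k))
  upToK-view (kth refl)    _ = sym (≤ᵇ-true (ℕP.≤-refl {k}))
  upToK-view (high k<r _)  _ = sym (≤ᵇ-false k<r)
  upToK-view (last refl)   _ = sym (≤ᵇ-false k<m)
  upToK-view (past m<r) r≤m = ⊥-elim (ℕP.<⇒≱ m<r r≤m)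

  region-after-last : (v : RowView (suc m)) → region v ≡ outside
  region-after-last (first m+1≡1)  = ⊥-elim (ℕP.<⇒≢ (ℕP.<-≤-trans (s≤s z≤n) k<m) (sym (ℕP.suc-injective m+1≡1)))
  region-after-last (low _ m+1<k)  = ⊥-elim (ℕP.<-asym (ℕP.<-trans k<m (ℕP.n<1+n m)) m+1<k)
  region-after-last (kth m+1≡k)    = ⊥-elim (ℕP.<⇒≢ (ℕP.<-trans k<m (ℕP.n<1+n m)) (sym m+1≡k))
  region-after-last (high _ m+1<m) = ⊥-elim (ℕP.<-asym m+1<m (ℕP.n<1+n m))
  region-after-last (last m+1≡m)   = ⊥-elim (ℕP.<⇒≢ (ℕP.n<1+n m) (sym m+1≡m))
  region-after-last (past _)       = refl

  RowsI-≤ : ∀ {x} → RowsI k m x → x ℕ.≤ m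
  RowsI-≤ (inj₁ (_ , x≤k)) = ℕP.≤-trans x≤k (ℕP.<⇒≤ k<m)
  RowsI-≤ (inj₂ refl)      = ℕP.≤-refl

  RowsK-≤ : ∀ {x} → RowsK k m x → x ℕ.≤ m
  RowsK-≤ (inj₁ refl)      = 1≤m
  RowsK-≤ (inj₂ (_ , x≤m)) = x≤m

  no-index-after-last : ∀ {P : ℕ → Set} → (∀ {x} → P x → x ℕ.≤ m) →
    ∀ {l} → Linked ℕ._<_ (m ∷ l) → All P l → l ≡ []
  no-index-after-last bounded {[]}    _          _         = refl
  no-index-after-last bounded {x ∷ _} (m<x ∷ _) (Px ∷ _)  = ⊥-elim (ℕP.<⇒≱ m<x (bounded Px))

  gain-rowTerm : ∀ {i} (v : RowView (suc i)) → suc i ℕ.≤ m → ∀ sI sK sI' sK' →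
    gain (region v) (stateAt i sI sK) (inside (suc i)) (cell (suc i)) sI' sK'
      ≡ weight sI sI' * excess (suc i) + weight sK sK' * excess (suc i) + rowTerm (suc i)
  gain-rowTerm {i} v r≤m sI sK sI' sK' = begin
    x + y - c - + ind (σ-cell heightReachesK (upToK (region v)) (inside (suc i)) (cell (suc i)))
      ≡⟨ cong (λ t → x + y - c - + ind (σ-cell heightReachesK t (inside (suc i)) (cell (suc i))))
              (upToK-view v r≤m) ⟩
    x + y - c - + σ-part (suc i)
      ≡⟨ regroup x y c (+ σ-part (suc i)) ⟩
    x + y + rowTerm (suc i) ∎
    where
    open ≡-Reasoning
    x = weight sI sI' * excess (suc i)
    y = weight sK sK' * excess (suc i)
    c = + changed (suc i)
    regroup : ∀ x y c s → x + y - c - s ≡ x + y + (- c - s)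
    regroup = solve-∀

  scan-bound : ∀ len {i} → len ℕ.+ i ≡ m → (v : RowView (suc i)) →
    ∀ {sI sK lI lK} → Pending NotK sI lI → Pending U sK lK →
    Linked ℕ._<_ (i ∷ lI) → Linked ℕ._<_ (i ∷ lK) → All (RowsI k m) lI → All (RowsK k m) lK →
    fin (remaining excess sI lI + remaining excess sK lK + (sumToℤ m rowTerm - sumToℤ i rowTerm))
      ≤∞ potential (region v) (stateAt i sI sK)
  scan-bound zero refl v {sI} {sK} pendI pendK linkedI linkedK allI allK
    with no-index-after-last RowsI-≤ linkedI allI | no-index-after-last RowsK-≤ linkedK allK
  ... | refl | refl
    rewrite finished pendI | finished pendK | region-after-last v | hole⇔overflow
          | outside-balanced (cell m) (inside m) heightReachesK (overflowBy m) =
    fin≤ (ℤP.≤-reflexive (trans (ℤP.+-identityˡ _) (ℤP.+-inverseʳ (sumToℤ m rowTerm))))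
  scan-bound (suc len) {i} len+i+1≡m v {sI} {sK} {lI} {lK} pendI pendK linkedI linkedK allI allK =
    ≤∞-trans (≤∞-reflexive regrouped)
    (≤∞-trans (+∞-monoʳ (gain R s a b I.phase K.phase) rest)
              (move-≤-potential edge s a b I.phase K.phase admissible-row))
    where
    r≤m : suc i ℕ.≤ m
    r≤m = subst (suc i ℕ.≤_) len+i+1≡m (s≤s (ℕP.m≤n+m i len))
    R = region v
    s = stateAt i sI sK
    a = inside (suc i)
    b = cell (suc i)
    v'   = proj₁ (next-view v r≤m)
    edge = proj₂ (next-view v r≤m)
    module I = Advance (advance excess (usesI-view v) (mayEndI-view v) pendI linkedI allI)
    module K = Advance (advance excess (usesK-view v) (λ _ → _) pendK linkedK allK)
    rest = scan-bound len (trans (ℕP.+-suc len i) len+i+1≡m) v' I.pending K.pending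
                      I.linked K.linked I.allowed K.allowed
    admissible-row : T (admissible R s a b I.phase K.phase)
    admissible-row = T-∧-intro (inside-antitone i) (T-∧-intro (rowOK-view v r≤m) (T-∧-intro I.legal K.legal))
    regrouped : fin (remaining excess sI lI + remaining excess sK lK + (sumToℤ m rowTerm - sumToℤ i rowTerm))
              ≡ gain R s a b I.phase K.phase
                  +∞ fin (remaining excess I.phase I.rest + remaining excess K.phase K.rest
                          + (sumToℤ m rowTerm - sumToℤ (suc i) rowTerm))
    regrouped = cong fin (begin
      remaining excess sI lI + remaining excess sK lK + (S - Σᵢ)
        ≡⟨ cong₂ (λ x y → x + y + (S - Σᵢ)) I.split K.split ⟩
      (p + I′) + (q + K′) + (S - Σᵢ)
        ≡⟨ regroup p q I′ K′ S Σᵢ (rowTerm (suc i)) ⟩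
      (p + q + rowTerm (suc i)) + (I′ + K′ + (S - (Σᵢ + rowTerm (suc i))))
        ≡⟨ cong (λ g → g + (I′ + K′ + (S - (Σᵢ + rowTerm (suc i)))))
                (sym (gain-rowTerm v r≤m sI sK I.phase K.phase)) ⟩
      gain R s a b I.phase K.phase + (I′ + K′ + (S - (Σᵢ + rowTerm (suc i)))) ∎)
      where
      open ≡-Reasoning
      S  = sumToℤ m rowTerm
      Σᵢ = sumToℤ i rowTerm
      p  = weight sI I.phase * excess (suc i)
      q  = weight sK K.phase * excess (suc i)
      I′ = remaining excess I.phase I.rest
      K′ = remaining excess K.phase K.rest
      regroup : ∀ p q x y s t l → (p + x) + (q + y) + (s - t) ≡ (p + q + l) + (x + y + (s - (t + l)))
      regroup = solve-∀

  column-bound : ∀ {lI lK} → IndexList (RowsI k m) NotK lI → IndexList (RowsK k m) U lK →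
    + 2 + alternating excess lI + alternating excess lK - sumToℤ k excess ≤ + boundary
  column-bound {lI} {lK} indicesI indicesK =
    subst₂ _≤_ (regroup A B L Σₖ) (cancel L) (ℤP.+-monoˡ-≤ (+ 2 + L) scanned)
    where
    module I = IndexList indicesI
    module K = IndexList indicesK
    A = alternating excess lI
    B = alternating excess lK
    L = + boundary
    Σₖ = sumToℤ k excess
    scanned : A + B + (- L - Σₖ) ≤ - + 2
    scanned with scan-bound m (ℕP.+-identityʳ m) (first refl) (pos I.oddWithLast) (pos K.oddWithLast)
                            I.increasing K.increasing I.allowed K.allowed
    ... | bound rewrite cell-0 | potential-start heightReachesK with bound
    ...   | fin≤ le = subst (_≤ - + 2) (cong (λ x → A + B + x) (trans (ℤP.+-identityʳ _) rowTerm-sum)) le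
    regroup : ∀ a b l s → a + b + (- l - s) + (+ 2 + l) ≡ + 2 + a + b - s
    regroup = solve-∀
    cancel : ∀ l → - + 2 + (+ 2 + l) ≡ l
    cancel = solve-∀

columnExcess : ∀ {m n} → Image m n → ℕ → ℕ → ℤ
columnExcess F j i = indDiff (i ℕ.≤ᵇ colSum F j) (inF F i j)

columnBoundary : ∀ {m n} → Image m n → ℕ → ℕ
columnBoundary {m} F j =
  sumTo m (λ i → if inF F i j then ind (not (inF F (i ℕ.∸ 1) j)) ℕ.+ ind (not (inF F (suc i) j)) else 0)

dSeq-columns : ∀ {m n} (F : Image m n) i → dSeq F i ≡ sumToℤ n (λ j → columnExcess F j i)
dSeq-columns {m} {n} F i =
  trans (cong₂ _-_ (+-sumTo n _) (+-sumTo n _)) (sym (sumToℤ-distrib-- n _ _))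

horizBoundary-columns : ∀ {m n} (F : Image m n) → + horizBoundary F ≡ sumToℤ n (λ j → + columnBoundary F j)
horizBoundary-columns {m} {n} F = begin
  + horizBoundary F                            ≡⟨ +-sumTo m _ ⟩
  sumToℤ m (λ i → + sumTo n (λ j → cell i j))  ≡⟨ sumToℤ-cong m (λ i _ _ → +-sumTo n _) ⟩
  sumToℤ m (λ i → sumToℤ n (λ j → + cell i j)) ≡⟨ sumToℤ-comm m n _ ⟩
  sumToℤ n (λ j → sumToℤ m (λ i → + cell i j)) ≡⟨ sumToℤ-cong n (λ j _ _ → sym (+-sumTo m _)) ⟩
  sumToℤ n (λ j → + columnBoundary F j)        ∎
  where
  open ≡-Reasoning
  cell : ℕ → ℕ → ℕ
  cell i j = if inF F i j then ind (not (inF F (i ℕ.∸ 1) j)) ℕ.+ ind (not (inF F (suc i) j)) else 0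

columnRHS : ∀ {m n} → Image m n → ℕ → List ℕ → List ℕ → ℕ → ℤ
columnRHS F k lI lK j =
  + 2 + alternating (columnExcess F j) lI + alternating (columnExcess F j) lK - sumToℤ k (columnExcess F j)

rhs-columns : ∀ {m n} (F : Image m n) k lI lK →
  + (2 ℕ.* n) + alternating (dSeq F) lI + alternating (dSeq F) lK - sumToℤ k (dSeq F)
    ≡ sumToℤ n (columnRHS F k lI lK)
rhs-columns {m} {n} F k lI lK = begin
  + (2 ℕ.* n) + alternating (dSeq F) lI + alternating (dSeq F) lK - sumToℤ k (dSeq F)
    ≡⟨ cong₂ _-_ (cong₂ _+_ (cong₂ _+_ twice (alternating-columns lI)) (alternating-columns lK)) σ-columns ⟩
  sumToℤ n (λ _ → + 2) + sumToℤ n (A lI) + sumToℤ n (A lK) - sumToℤ n Σₖ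
    ≡⟨ cong (_- sumToℤ n Σₖ) (cong (_+ sumToℤ n (A lK)) (sym (sumToℤ-distrib-+ n _ (A lI)))) ⟩
  sumToℤ n (λ j → + 2 + A lI j) + sumToℤ n (A lK) - sumToℤ n Σₖ
    ≡⟨ cong (_- sumToℤ n Σₖ) (sym (sumToℤ-distrib-+ n _ (A lK))) ⟩
  sumToℤ n (λ j → + 2 + A lI j + A lK j) - sumToℤ n Σₖ
    ≡⟨ sym (sumToℤ-distrib-- n _ Σₖ) ⟩
  sumToℤ n (columnRHS F k lI lK) ∎
  where
  open ≡-Reasoning
  A : List ℕ → ℕ → ℤ
  A l j = alternating (columnExcess F j) l
  Σₖ : ℕ → ℤ
  Σₖ j = sumToℤ k (columnExcess F j)
  twice : + (2 ℕ.* n) ≡ sumToℤ n (λ _ → + 2)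
  twice = trans (cong +_ (ℕP.*-comm 2 n)) (sym (sumToℤ-const n 2))
  alternating-columns : ∀ l → alternating (dSeq F) l ≡ sumToℤ n (A l)
  alternating-columns l =
    trans (alternating-cong (dSeq-columns F) l) (alternating-sumToℤ n (λ j i → columnExcess F j i) l)
  σ-columns : sumToℤ k (dSeq F) ≡ sumToℤ n Σₖ
  σ-columns = trans (sumToℤ-cong k (λ i _ _ → dSeq-columns F i)) (sumToℤ-comm k n (λ i j → columnExcess F j i))

dSeq-nonneg : ∀ {m n} (F : Image m n) i → rowSum F i ≡ 0 → + 0 ≤ dSeq F i
dSeq-nonneg F i empty rewrite empty = +≤+ z≤n

image-bound : ∀ {m n} (F : Image m n) → rowSum F 1 ≡ n → rowSum F m ≡ 0 →
  ∀ {k} → 2 ℕ.≤ k → k ℕ.< m →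
  ∀ {lI lK} → IndexList (RowsI k m) (λ x → ¬ x ≡ k) lI → IndexList (RowsK k m) U lK →
  + (2 ℕ.* n) + alternating (dSeq F) lI + alternating (dSeq F) lK - sumToℤ k (dSeq F) ≤ + horizBoundary F
image-bound {m} {n} F row-1 row-m {k} 2≤k k<m {lI} {lK} indicesI indicesK = begin
  + (2 ℕ.* n) + alternating (dSeq F) lI + alternating (dSeq F) lK - sumToℤ k (dSeq F)
    ≡⟨ rhs-columns F k lI lK ⟩
  sumToℤ n (columnRHS F k lI lK)
    ≤⟨ sumToℤ-mono-≤ n column ⟩
  sumToℤ n (λ j → + columnBoundary F j)
    ≡⟨ sym (horizBoundary-columns F) ⟩
  + horizBoundary F ∎
  where
  open ℤP.≤-Reasoning
  column : ∀ j → 1 ℕ.≤ j → j ℕ.≤ n → columnRHS F k lI lK j ≤ + columnBoundary F j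
  column j 1≤j j≤n = Column.column-bound m k (λ i → inF F i j) 2≤k k<m refl
    (sumTo-all-ones n (λ j → inF F 1 j) row-1 1≤j j≤n) (sumTo-all-zeros n (λ j → inF F m j) row-m 1≤j j≤n)
    indicesI indicesK

theorem5p1 : (m n : ℕ) → 1 ℕ.≤ m → 1 ℕ.≤ n → (F : Image m n) →
    rowSum F 1 ≡ n → rowSum F m ≡ 0 →
    (k : ℕ) → 2 ℕ.≤ k → k ℕ.≤ m ℕ.∸ 1 →
    dSeq F k < + 0 → + 0 ≤ dSeq F (suc k) →
    (t s : ℕ) →
    (ι : Fin (suc (2 ℕ.* t)) → ℕ) →
    (∀ p q → p Fin.< q → ι p ℕ.< ι q) →
    (∀ p → (1 ℕ.≤ ι p × ι p ℕ.≤ k) ⊎ ι p ≡ m) →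
    (κ : Fin (suc (2 ℕ.* s)) → ℕ) →
    (∀ p q → p Fin.< q → κ p ℕ.< κ q) →
    (∀ p → κ p ≡ 1 ⊎ (suc k ℕ.≤ κ p × κ p ℕ.≤ m)) →
    + horizBoundary F ≥
      ((+ (2 ℕ.* n) + altExpr (dSeq F) t ι + altExpr (dSeq F) s κ)
        - sumToℤ k (dSeq F))
theorem5p1 (suc m') n _ _ F row-1 row-m k 2≤k k≤m' dk<0 _ t s ι ι-mono ι-rows κ κ-mono κ-rows = begin
  + (2 ℕ.* n) + altExpr d t ι + altExpr d s κ - sumToℤ k d
    ≡⟨ cong₂ (λ a b → + (2 ℕ.* n) + a + b - sumToℤ k d)
             (altExpr-alternating d t ι) (altExpr-alternating d s κ) ⟩
  + (2 ℕ.* n) + alternating d (tabulate ι) + alternating d (tabulate κ) - sumToℤ k d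
    ≤⟨ ℤP.+-monoˡ-≤ (- sumToℤ k d) (ℤP.+-monoˡ-≤ (alternating d (tabulate κ))
         (ℤP.+-monoʳ-≤ (+ (2 ℕ.* n)) (alternating-redirect d dk≤dm (tabulate ι)))) ⟩
  + (2 ℕ.* n) + alternating d (redirect (tabulate ι)) + alternating d (tabulate κ) - sumToℤ k d
    ≤⟨ image-bound F row-1 row-m 2≤k k<m
         (redirect-indexList k<m (inj₂ refl)
           (tabulate-indexList (RowsI-positive (s≤s z≤n)) (even-double t) ι ι-mono ι-rows))
         (tabulate-indexList RowsK-positive (even-double s) κ κ-mono κ-rows) ⟩
  + horizBoundary F ∎
  where
  open ℤP.≤-Reasoning
  open Redirect k (suc m')
  d = dSeq F
  k<m : k ℕ.< suc m'
  k<m = s≤s k≤m'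
  dk≤dm : d k ≤ d (suc m')
  dk≤dm = ℤP.≤-trans (ℤP.<⇒≤ dk<0) (dSeq-nonneg F (suc m') row-m)
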